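{- Let $T$ be a tiling of the $n$-gon $P$ and consider the strands of the Scott strand construction for $T$. If a strand leaves a tile of $T$ through an edge $e$, then it never afterwards crosses $e$ again.
   Context: Let $P$ be a convex polygon with vertices $1,\dots,n$ ($n\ge3$) in clockwise order. A tiling $T$ is a (possibly empty) set of pairwise non-crossing (in their interiors) diagonals; tiles are the closures of the components of $P$ minus the diagonals. Scott strand construction: for each tile $Q$ with vertices $q_1,\dots,q_r$ in clockwise order (indices mod $r$) and each $j$, draw inside $Q$ a strand segment parallel to $[q_{j-1},q_j]$, entering $Q$ through the side $[q_j,q_{j+1}]$ near $q_j$ and leaving $Q$ through the side $[q_{j-2},q_{j-1}]$ near $q_{j-1}$; if the entering side is a boundary edge of $P$ the segment starts at vertex $q_j$, and if the leaving side is a boundary edge of $P$ it ends at vertex $q_{j-1}$. At a diagonal $d$ shared by two tiles, a segment leaving one tile through $d$ near an endpoint $v$ is continued by the segment of the other tile entering through $d$ near $v$. The resulting concatenated oriented curves are the strands; each starts and ends at a vertex of $P$. -}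

module Defs where

open import Data.Nat using (ℕ; suc; _≤_)
open import Data.Fin using (Fin; toℕ; _<_)
open import Data.List using (List; []; _∷_; _++_; length)
open import Data.List.Membership.Propositional using (_∈_)
open import Data.List.Relation.Unary.Linked using (Linked)
open import Data.Product using (Σ; _×_; _,_)
open import Data.Sum using (_⊎_)
open import Relation.Nullary using (¬_)
open import Relation.Binary.PropositionalEquality using (_≡_)

-- Vertices of the n-gon P are Fin n = {0,…,n-1} (the paper's 1,…,n),
-- clockwise order = increasing index.

Succ : {n : ℕ} → Fin n → Fin n → Set
Succ {n} x y = (suc (toℕ x) ≡ toℕ y) ⊎ ((suc (toℕ x) ≡ n) × (toℕ y ≡ 0))

BoundaryEdge : {n : ℕ} → Fin n → Fin n → Set
BoundaryEdge x y = Succ x y ⊎ Succ y x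

IsDiagonal : {n : ℕ} → Fin n × Fin n → Set
IsDiagonal (a , b) = (a < b) × ¬ BoundaryEdge a b

Crosses : {n : ℕ} → Fin n × Fin n → Fin n × Fin n → Set
Crosses (a , b) (c , d) = (a < c) × (c < b) × (b < d)

IsTiling : (n : ℕ) → List (Fin n × Fin n) → Set
IsTiling n T = (∀ {d} → d ∈ T → IsDiagonal d)
             × (∀ {d e} → d ∈ T → e ∈ T → ¬ Crosses d e)

InT : {n : ℕ} → List (Fin n × Fin n) → Fin n → Fin n → Set
InT T x y = ((x , y) ∈ T) ⊎ ((y , x) ∈ T)

IsSide : {n : ℕ} → List (Fin n × Fin n) → Fin n → Fin n → Set
IsSide T x y = BoundaryEdge x y ⊎ InT T x y

data Consec {A : Set} : List A → A → A → Set where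
  here  : ∀ {x y zs} → Consec (x ∷ y ∷ zs) x y
  there : ∀ {w zs x y} → Consec zs x y → Consec (w ∷ zs) x y

closeUp : {A : Set} → List A → List A
closeUp []       = []
closeUp (q ∷ qs) = q ∷ (qs ++ (q ∷ []))

CycConsec : {A : Set} → List A → A → A → Set
CycConsec Q x y = Consec (closeUp Q) x y

record IsTile {n : ℕ} (T : List (Fin n × Fin n)) (Q : List (Fin n)) : Set where
  field
    atLeast3    : 3 ≤ length Q
    clockwise   : Linked _<_ Q
    sidesInT    : ∀ {x y} → CycConsec Q x y → IsSide T x y
    noInnerDiag : ∀ {x y} → x ∈ Q → y ∈ Q → InT T x y
                → CycConsec Q x y ⊎ CycConsec Q y x

-- Strand states: an oriented pair (a , b) = "the strand enters the tile Q
-- in which b follows a clockwise, through the side [a,b], near a".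
-- In Q = (…, q_{j-2}, q_{j-1}, q_j = a, q_{j+1} = b, …) the segment leaves
-- through [q_{j-2}, q_{j-1}] near q_{j-1}; if that side is a diagonal of T
-- the strand continues into the neighbouring tile in state (q_{j-1}, q_{j-2}).
Step : {n : ℕ} → List (Fin n × Fin n) → Fin n × Fin n → Fin n × Fin n → Set
Step {n} T (a , b) (c , d) =
  Σ (List (Fin n)) λ Q →
    IsTile T Q × CycConsec Q a b × CycConsec Q c a × CycConsec Q d c × InT T c d

-- StrandCrossings T s xs : starting in state s, the strand successively
-- leaves tiles through (i.e. crosses) the diagonals xs (each recorded in
-- the orientation in which the strand enters the next tile).
data StrandCrossings {n : ℕ} (T : List (Fin n × Fin n))
     : Fin n × Fin n → List (Fin n × Fin n) → Set where
  []  : ∀ {s} → StrandCrossings T s []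
  _∷_ : ∀ {s s' xs} → Step T s s' → StrandCrossings T s' xs
      → StrandCrossings T s (s' ∷ xs)

SameEdge : {n : ℕ} → Fin n × Fin n → Fin n × Fin n → Set
SameEdge (a , b) (c , d) = ((a ≡ c) × (b ≡ d)) ⊎ ((a ≡ d) × (b ≡ c))

-- A strand in state (c , d) has just entered a tile through the side
-- [c , d]; record this by the half-open clockwise arc [c , d) of vertices
-- of P. The strand leaves that tile through [c' , d'], where d', c', c, d
-- are consecutive vertices of the tile, so [c , d) lies inside the open
-- arc (c' , d'). These arcs therefore strictly increase along the strand,
-- whereas crossing an earlier edge again, in either orientation, would
-- give an arc that does not contain the earlier one.
module Submission where

open import Defs
open import Data.Nat using (ℕ; _≤_; s≤s)
open import Data.Nat.Properties using (≤-trans; n≤1+n)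
open import Data.Fin using (Fin)
import Data.Fin.Properties as Fin
open import Data.Empty using (⊥; ⊥-elim)
open import Data.List using (List; []; _∷_; _++_; length)
open import Data.List.Membership.Propositional using (_∈_)
open import Data.List.Relation.Unary.All as All using (All)
open import Data.List.Relation.Unary.Any using (here; there)
open import Data.List.Relation.Unary.AllPairs as AllPairs using (AllPairs; _∷_)
open import Data.List.Relation.Unary.Linked using (Linked; []; [-]; _∷_)
open import Data.List.Relation.Unary.Linked.Properties using (Linked⇒AllPairs)
open import Data.Product using (_×_; _,_; proj₁; proj₂)
open import Data.Sum using (_⊎_; inj₁; inj₂; [_,_]; swap)
open import Level using (0ℓ)
open import Relation.Binary.Core using (Rel)
open import Relation.Binary.Definitions using (tri<; tri≈; tri>)
open import Relation.Binary.Structures using (IsStrictTotalOrder)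
open import Relation.Binary.PropositionalEquality using (_≡_; _≢_; refl; sym)
open import Relation.Nullary using (¬_)

module CyclicOrder {A : Set} {_<_ : Rel A 0ℓ} (sto : IsStrictTotalOrder _≡_ _<_) where

  open IsStrictTotalOrder sto using (compare; irrefl; trans; asym)

  -- The open clockwise arc from a to b on a circle whose points are listed
  -- in increasing order; for a ≡ b it is everything except a.
  InArc : A → A → A → Set
  InArc a b z = (a < z × z < b) ⊎ (¬ a < b × (a < z ⊎ z < b))

  InArc-source : ∀ {a b} → ¬ InArc a b a
  InArc-source (inj₁ (a<a , _))        = irrefl refl a<a
  InArc-source (inj₂ (_ , inj₁ a<a))   = irrefl refl a<a
  InArc-source (inj₂ (a≮b , inj₂ a<b)) = a≮b a<b

  InArc-target : ∀ {a b} → ¬ InArc a b b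
  InArc-target (inj₁ (_ , b<b))        = irrefl refl b<b
  InArc-target (inj₂ (a≮b , inj₁ a<b)) = a≮b a<b
  InArc-target (inj₂ (_ , inj₂ b<b))   = irrefl refl b<b

  arc-cover : ∀ u v x → x ≡ u ⊎ x ≡ v ⊎ InArc u v x ⊎ InArc v u x
  arc-cover u v x with compare u v | compare x u | compare x v
  ... | _              | tri≈ _ x≡u _   | _              = inj₁ x≡u
  ... | _              | _              | tri≈ _ x≡v _   = inj₂ (inj₁ x≡v)
  ... | tri< u<v _ _   | tri< x<u _ _   | _              = inj₂ (inj₂ (inj₂ (inj₂ (asym u<v , inj₂ x<u))))
  ... | tri< _ _ _     | tri> _ _ u<x   | tri< x<v _ _   = inj₂ (inj₂ (inj₁ (inj₁ (u<x , x<v))))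
  ... | tri< u<v _ _   | _              | tri> _ _ v<x   = inj₂ (inj₂ (inj₂ (inj₂ (asym u<v , inj₁ v<x))))
  ... | tri≈ _ refl _  | tri< x<u _ _   | _              = inj₂ (inj₂ (inj₁ (inj₂ (irrefl refl , inj₂ x<u))))
  ... | tri≈ _ refl _  | tri> _ _ u<x   | _              = inj₂ (inj₂ (inj₁ (inj₂ (irrefl refl , inj₁ u<x))))
  ... | tri> _ _ v<u   | _              | tri< x<v _ _   = inj₂ (inj₂ (inj₁ (inj₂ (asym v<u , inj₂ x<v))))
  ... | tri> _ _ _     | tri< x<u _ _   | tri> _ _ v<x   = inj₂ (inj₂ (inj₂ (inj₁ (v<x , x<u))))
  ... | tri> _ _ v<u   | tri> _ _ u<x   | _              = inj₂ (inj₂ (inj₁ (inj₂ (asym v<u , inj₁ u<x))))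

  arc-overlap-< : ∀ {x y x' y' z} → x < x' → InArc x y z → InArc x' y' z
                → InArc x y x' ⊎ InArc x' y' x
  arc-overlap-< x<x' (inj₂ (x≮y , _))     _                          = inj₁ (inj₂ (x≮y , inj₁ x<x'))
  arc-overlap-< x<x' (inj₁ (_ , z<y))     (inj₁ (x'<z , _))          = inj₁ (inj₁ (x<x' , trans x'<z z<y))
  arc-overlap-< x<x' (inj₁ (_ , z<y))     (inj₂ (_ , inj₁ x'<z))     = inj₁ (inj₁ (x<x' , trans x'<z z<y))
  arc-overlap-< x<x' (inj₁ (x<z , _))     (inj₂ (x'≮y' , inj₂ z<y')) = inj₂ (inj₂ (x'≮y' , inj₂ (trans x<z z<y')))

  arc-overlap : ∀ {x y x' y' z} → x ≢ x' → InArc x y z → InArc x' y' z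
              → InArc x y x' ⊎ InArc x' y' x
  arc-overlap {x} {x' = x'} x≢x' p q with compare x x'
  ... | tri< x<x' _ _ = arc-overlap-< x<x' p q
  ... | tri≈ _ x≡x' _ = ⊥-elim (x≢x' x≡x')
  ... | tri> _ _ x'<x = swap (arc-overlap-< x'<x q p)

  ascending-triple-not-in-pair : ∀ {u v w a b} → u < v → v < w
    → u ≡ a ⊎ u ≡ b → v ≡ a ⊎ v ≡ b → w ≡ a ⊎ w ≡ b → ⊥
  ascending-triple-not-in-pair u<v _   (inj₁ refl) (inj₁ refl) _           = irrefl refl u<v
  ascending-triple-not-in-pair u<v _   (inj₂ refl) (inj₂ refl) _           = irrefl refl u<v
  ascending-triple-not-in-pair _   v<w _           (inj₁ refl) (inj₁ refl) = irrefl refl v<w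
  ascending-triple-not-in-pair _   v<w _           (inj₂ refl) (inj₂ refl) = irrefl refl v<w
  ascending-triple-not-in-pair u<v v<w (inj₁ refl) (inj₂ refl) (inj₁ refl) = irrefl refl (trans u<v v<w)
  ascending-triple-not-in-pair u<v v<w (inj₂ refl) (inj₁ refl) (inj₂ refl) = irrefl refl (trans u<v v<w)

  consec-∈ : ∀ {L : List A} {x y} → Consec L x y → x ∈ L × y ∈ L
  consec-∈ here      = here refl , there (here refl)
  consec-∈ (there c) = there (proj₁ (consec-∈ c)) , there (proj₂ (consec-∈ c))

  consec-< : ∀ {L x y} → AllPairs _<_ L → Consec L x y → x < y
  consec-< (x<L ∷ _) here      = All.head x<L
  consec-< (_ ∷ sorted) (there c) = consec-< sorted c

  consec-nothing-between : ∀ {L x y z} → AllPairs _<_ L → Consec L x y → z ∈ L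
                         → ¬ (x < z × z < y)
  consec-nothing-between _ here (here refl) (x<x , _) = irrefl refl x<x
  consec-nothing-between _ here (there (here refl)) (_ , y<y) = irrefl refl y<y
  consec-nothing-between (_ ∷ y<zs ∷ _) here (there (there z∈zs)) (_ , z<y) =
    asym z<y (All.lookup y<zs z∈zs)
  consec-nothing-between (w<L ∷ _) (there c) (here refl) (x<w , _) =
    asym x<w (All.lookup w<L (proj₁ (consec-∈ c)))
  consec-nothing-between (_ ∷ sorted) (there c) (there z∈L) = consec-nothing-between sorted c z∈L

  consec-snoc : ∀ {L w x y} → AllPairs _<_ L → Consec (L ++ w ∷ []) x y
              → Consec L x y ⊎ (y ≡ w × x ∈ L × (∀ {z} → z ∈ L → ¬ x < z))
  consec-snoc {[]}        _ (there ())
  consec-snoc {_ ∷ []}    _ here = inj₂ (refl , here refl , λ { (here refl) → irrefl refl })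
  consec-snoc {_ ∷ []}    _ (there (there ()))
  consec-snoc {_ ∷ _ ∷ _} _ here = inj₁ here
  consec-snoc {_ ∷ _ ∷ _} (a<L ∷ sorted) (there c) with consec-snoc sorted c
  ... | inj₁ c'                 = inj₁ (there c')
  ... | inj₂ (y≡w , x∈L , xmax) = inj₂ (y≡w , there x∈L , λ where
          (here refl) x<a → asym x<a (All.lookup a<L x∈L)
          (there z∈L)     → xmax z∈L)

  head-minimal : ∀ {q L z} → AllPairs _<_ (q ∷ L) → z ∈ q ∷ L → ¬ z < q
  head-minimal _         (here refl) = irrefl refl
  head-minimal (q<L ∷ _) (there z∈L) z<q = asym z<q (All.lookup q<L z∈L)

  record Side (Q : List A) (x y : A) : Set where
    field
      source∈        : x ∈ Q
      target∈        : y ∈ Q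
      source≢target  : x ≢ y
      nothingBetween : ∀ {z} → z ∈ Q → ¬ InArc x y z
  open Side

  sorted-cycConsec⇒Side : ∀ {Q x y} → AllPairs _<_ Q → 2 ≤ length Q → CycConsec Q x y → Side Q x y
  sorted-cycConsec⇒Side {_ ∷ []}    _ (s≤s ()) _
  sorted-cycConsec⇒Side {q ∷ _ ∷ _} sorted _ c with consec-snoc sorted c
  ... | inj₁ c' = record
    { source∈        = proj₁ (consec-∈ c')
    ; target∈        = proj₂ (consec-∈ c')
    ; source≢target  = λ { refl → irrefl refl x<y }
    ; nothingBetween = λ where
        z∈Q (inj₁ between)   → consec-nothing-between sorted c' z∈Q between
        _   (inj₂ (x≮y , _)) → x≮y x<y
    }
    where x<y = consec-< sorted c'
  ... | inj₂ (refl , x∈Q , xmax) = record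
    { source∈        = x∈Q
    ; target∈        = here refl
    ; source≢target  = λ { refl → xmax (there (here refl)) (All.head (AllPairs.head sorted)) }
    ; nothingBetween = λ where
        z∈Q (inj₁ (x<z , _))        → xmax z∈Q x<z
        z∈Q (inj₂ (_ , inj₁ x<z))   → xmax z∈Q x<z
        z∈Q (inj₂ (_ , inj₂ z<q))   → head-minimal sorted z∈Q z<q
    }

  Side-asym : ∀ {Q x y} → AllPairs _<_ Q → 3 ≤ length Q → Side Q x y → Side Q y x → ⊥
  Side-asym {_ ∷ []}     _ (s≤s ()) _ _
  Side-asym {_ ∷ _ ∷ []} _ (s≤s (s≤s ())) _ _
  Side-asym {q₁ ∷ q₂ ∷ q₃ ∷ _} {x} {y} (q₁<L ∷ q₂<L ∷ _) _ xy yx =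
    ascending-triple-not-in-pair (All.head q₁<L) (All.head q₂<L)
      (endpoint (here refl)) (endpoint (there (here refl))) (endpoint (there (there (here refl))))
    where
      endpoint : ∀ {z} → z ∈ q₁ ∷ q₂ ∷ q₃ ∷ _ → z ≡ x ⊎ z ≡ y
      endpoint {z} z∈Q with arc-cover x y z
      ... | inj₁ z≡x               = inj₁ z≡x
      ... | inj₂ (inj₁ z≡y)        = inj₂ z≡y
      ... | inj₂ (inj₂ (inj₁ arc)) = ⊥-elim (nothingBetween xy z∈Q arc)
      ... | inj₂ (inj₂ (inj₂ arc)) = ⊥-elim (nothingBetween yx z∈Q arc)

  _⊏_ : A × A → A × A → Set
  (c , d) ⊏ (c' , d') = ∀ {x} → x ≡ c ⊎ InArc c d x → InArc c' d' x

  ⊏-trans : ∀ {e f g} → e ⊏ f → f ⊏ g → e ⊏ g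
  ⊏-trans e⊏f f⊏g x∈e = f⊏g (inj₂ (e⊏f x∈e))

  ⊏-irrefl : ∀ {e} → ¬ e ⊏ e
  ⊏-irrefl e⊏e = InArc-source (e⊏e (inj₁ refl))

  ⊏-not-reverse : ∀ {c d} → ¬ (c , d) ⊏ (d , c)
  ⊏-not-reverse cd⊏dc = InArc-target (cd⊏dc (inj₁ refl))

  consecutive-sides⇒⊏ : ∀ {Q c d c' d'} → Side Q c d → Side Q c' c → Side Q d' c' → d' ≢ c
                      → (c , d) ⊏ (c' , d')
  consecutive-sides⇒⊏ {c = c} {d} {c'} {d'} cd c'c d'c' d'≢c {x} x∈cd with arc-cover c' d' x | x∈cd
  ... | inj₁ refl               | inj₁ c'≡c = ⊥-elim (source≢target c'c c'≡c)
  ... | inj₁ refl               | inj₂ arc  = ⊥-elim (nothingBetween cd (source∈ c'c) arc)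
  ... | inj₂ (inj₁ refl)        | inj₁ d'≡c = ⊥-elim (d'≢c d'≡c)
  ... | inj₂ (inj₁ refl)        | inj₂ arc  = ⊥-elim (nothingBetween cd (source∈ d'c') arc)
  ... | inj₂ (inj₂ (inj₁ arc))  | _         = arc
  ... | inj₂ (inj₂ (inj₂ arc))  | inj₁ refl = ⊥-elim (nothingBetween d'c' (target∈ c'c) arc)
  ... | inj₂ (inj₂ (inj₂ arc))  | inj₂ arc' =
    ⊥-elim ([ nothingBetween cd (source∈ d'c') , nothingBetween d'c' (target∈ c'c) ]
            (arc-overlap (λ c≡d' → d'≢c (sym c≡d')) arc' arc))

module _ {n : ℕ} where

  open CyclicOrder (Fin.<-isStrictTotalOrder {n})

  tile-sorted : ∀ {T Q} → IsTile {n} T Q → AllPairs Data.Fin._<_ Q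
  tile-sorted tile = Linked⇒AllPairs Fin.<-trans (IsTile.clockwise tile)

  tile-side : ∀ {T Q x y} → IsTile {n} T Q → CycConsec Q x y → Side Q x y
  tile-side tile = sorted-cycConsec⇒Side (tile-sorted tile) (≤-trans (n≤1+n 2) (IsTile.atLeast3 tile))

  step-⊏ : ∀ {T s s'} → Step {n} T s s' → s ⊏ s'
  step-⊏ (Q , tile , cd , c'c , d'c' , _) =
    consecutive-sides⇒⊏ (tile-side tile cd) (tile-side tile c'c) (tile-side tile d'c')
      λ { refl → Side-asym (tile-sorted tile) (IsTile.atLeast3 tile) (tile-side tile d'c') (tile-side tile c'c) }

  crossings-⊏-linked : ∀ {T s xs} → StrandCrossings {n} T s xs → Linked _⊏_ xs
  crossings-⊏-linked []                 = []
  crossings-⊏-linked (_ ∷ [])           = [-]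
  crossings-⊏-linked (_ ∷ st ∷ crossings) = step-⊏ st ∷ crossings-⊏-linked (st ∷ crossings)

  ⊏⇒¬SameEdge : ∀ {e f : Fin n × Fin n} → e ⊏ f → ¬ SameEdge e f
  ⊏⇒¬SameEdge e⊏f (inj₁ (refl , refl)) = ⊏-irrefl e⊏f
  ⊏⇒¬SameEdge e⊏f (inj₂ (refl , refl)) = ⊏-not-reverse e⊏f

  crossings-distinct : ∀ {T s xs} → StrandCrossings {n} T s xs → AllPairs (λ e f → ¬ SameEdge e f) xs
  crossings-distinct crossings =
    AllPairs.map ⊏⇒¬SameEdge (Linked⇒AllPairs ⊏-trans (crossings-⊏-linked crossings))

mainTheorem5 : (n : ℕ) → 3 ≤ n → (T : List (Fin n × Fin n)) → IsTiling n T
    → (i j : Fin n) → Succ i j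
    → (xs : List (Fin n × Fin n)) → StrandCrossings T (i , j) xs
    → AllPairs (λ e f → ¬ SameEdge e f) xs
mainTheorem5 _ _ _ _ _ _ _ _ = crossings-distinct
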